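{- Every packed word $w$ can be written uniquely as $w=v_1*v_2*\cdots*v_n$ (with $n\ge 0$), where $v_1,\dots,v_n$ are non-trivial irreducible packed words. Consequently, the set of packed words with the shifted concatenation is a free monoid on the irreducible packed words.
   Context: Let $X=\{x_i\}_{i\ge 0}$ be an alphabet indexed by the nonnegative integers and $X^*$ the set of words over $X$, with empty word $1_{X^*}$. For a word $w=x_{i_1}\cdots x_{i_m}$, $IAlph(w)=\{i_1,\dots,i_m\}$ and $sup(w)=\max IAlph(w)$, with $sup(w)=0$ if $IAlph(w)=\emptyset$. For a map $\phi$ on $IAlph(w)$ with values in $\mathbb{N}$ and $\phi(0)=0$, $S_\phi(w)=x_{\phi(i_1)}\cdots x_{\phi(i_m)}$. If $IAlph(w)\setminus\{0\}=\{j_1<\dots<j_k\}$, let $\phi_w(j_m)=m$, $\phi_w(0)=0$, and $pack(w)=S_{\phi_w}(w)$; $w$ is packed if $pack(w)=w$. For $t\in\mathbb{N}$, $T_t(w)=S_\phi(w)$ with $\phi(0)=0$ and $\phi(n)=n+t$ for $n>0$. The shifted concatenation is $u*v=u\,T_{sup(u)}(v)$; it maps pairs of packed words to packed words. A packed word $w$ is irreducible if it cannot be written as $w=u*v$ with $u,v$ non-trivial (i.e. non-empty) packed words. An empty product ($n=0$) is the empty word. -}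

module Defs where

open import Data.Nat using (ℕ; zero; suc; _+_; _⊔_)
open import Data.Nat.Properties using (_≟_)
open import Data.List using (List; []; _∷_; map; foldr; filter; length; _++_)
open import Data.List.Membership.DecPropositional _≟_ using (_∈?_)
open import Data.Product using (Σ; ∃; _×_)
open import Relation.Binary.PropositionalEquality using (_≡_; _≢_)
open import Relation.Nullary using (¬_)

-- A word over X = {x_i} is a list of indices: x_{i1}...x_{im} ↦ i1 ∷ ... ∷ im ∷ [].
Word : Set
Word = List ℕ

sup : Word → ℕ
sup = foldr _⊔_ 0

range1 : ℕ → List ℕ
range1 zero = []
range1 (suc j) = range1 j ++ (suc j ∷ [])

-- φ_w : φ_w(0) = 0, and for j ∈ IAlph(w)\{0}, φ_w(j) = m where j is the
-- m-th smallest element of IAlph(w)\{0}, i.e. m = #{ i ∈ IAlph(w) | 1 ≤ i ≤ j }.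
φ : Word → ℕ → ℕ
φ w j = length (filter (λ i → i ∈? w) (range1 j))

S : (ℕ → ℕ) → Word → Word
S f w = map f w

pack : Word → Word
pack w = S (φ w) w

Packed : Word → Set
Packed w = pack w ≡ w

shiftIdx : ℕ → ℕ → ℕ
shiftIdx t zero = zero
shiftIdx t (suc n) = suc n + t

T : ℕ → Word → Word
T t = S (shiftIdx t)

infixr 6 _⋆_
_⋆_ : Word → Word → Word
u ⋆ v = u ++ T (sup u) v

⋆-prod : List Word → Word
⋆-prod = foldr _⋆_ []

NonTrivial : Word → Set
NonTrivial w = w ≢ []

Irreducible : Word → Set
Irreducible w = Packed w ×
  ¬ (Σ Word λ u → Σ Word λ v →
       Packed u × Packed v × NonTrivial u × NonTrivial v × w ≡ u ⋆ v)

-- A word is packed exactly when the set of its nonzero letters is an initial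
-- segment {1, …, k} of ℕ. Since the letters contributed by v to u * v all lie
-- above sup(u), the right factor v of a packed word u * v is again packed.
-- Existence then follows by splitting reducible words, by induction on length.
-- For uniqueness, suppose w = v * x = v′ * x′ with v, v′ irreducible and v no
-- longer than v′. Then v′ = v m for a prefix m of T_{sup v}(x), so m = T_{sup v}(b)
-- for a prefix b of x and v′ = v * b with b packed; irreducibility of v′ forces
-- b to be empty, hence v = v′, and x = x′ because T_{sup v} is injective.
module Submission where

open import Defs
open import Data.Empty using (⊥-elim)
open import Data.Nat using (zero; suc; _+_; _⊔_; _∸_; _≤_; _<_; z≤n; s≤s; z<s)
open import Data.Nat.Induction using (<-wellFounded)
open import Data.Nat.Properties hiding (nonTrivial?)
open import Data.List using (List; []; _∷_; map; filter; length; _++_)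
open import Data.List.Membership.DecPropositional _≟_ using (_∈?_; _∈_)
open import Data.List.Membership.Propositional.Properties
  using (∈-++⁻; ∈-++⁺ˡ; ∈-++⁺ʳ; ∈-map⁺; ∈-map⁻)
open import Data.List.Properties
  using ( ≡-dec; ∷-injective; map-id; map-cong; map-id-local; map-injective; map-++
        ; length-map; length-++; ++-assoc; ++-identityʳ; ++-cancelˡ; ++-conicalˡ
        ; filter-all; filter-complete)
open import Data.List.Relation.Unary.All using (All; []; _∷_; tabulate; lookup)
open import Data.List.Relation.Unary.All.Properties using (all-filter; ++⁺)
open import Data.List.Relation.Unary.Any using (here; there)
open import Data.Product using (Σ; ∃; _×_; _,_; proj₁; proj₂)
import Data.Product as Product
open import Data.Sum using (_⊎_; inj₁; inj₂)
open import Function using (_on_; _∘′_)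
open import Induction.WellFounded using (Acc; acc)
open import Relation.Binary.Construct.On using (wellFounded)
open import Relation.Binary.PropositionalEquality
open import Relation.Nullary using (¬_; Dec; yes; no)
open import Relation.Nullary.Decidable using (map′; _×-dec_; _⊎-dec_; ¬?)

private
  variable
    A B : Set

map-id-local⁻ : ∀ {f : A → A} {xs} → map f xs ≡ xs → All (λ x → f x ≡ x) xs
map-id-local⁻ {xs = []}     _  = []
map-id-local⁻ {xs = x ∷ xs} eq =
  proj₁ (∷-injective eq) ∷ map-id-local⁻ (proj₂ (∷-injective eq))

++-prefix : ∀ (a c : List A) {x y} → length a ≤ length c → a ++ x ≡ c ++ y →
            Σ (List A) λ m → c ≡ a ++ m × x ≡ m ++ y
++-prefix []      c       _         eq = c , refl , eq
++-prefix (p ∷ a) (q ∷ c) (s≤s a≤c) eq with ∷-injective eq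
... | refl , eq′ = Product.map₂ (Product.map₁ (cong (p ∷_))) (++-prefix a c a≤c eq′)

map-prefix : ∀ (f : A → B) xs m {y} → map f xs ≡ m ++ y → ∃ λ ys → map f ys ≡ m
map-prefix f _        []      _  = [] , refl
map-prefix f []       (_ ∷ _) ()
map-prefix f (x ∷ xs) (_ ∷ m) eq with ∷-injective eq
... | refl , eq′ = Product.map (x ∷_) (cong (f x ∷_)) (map-prefix f xs m eq′)

Splitting : (List A → List A → Set) → List A → Set
Splitting {A = A} P w = Σ (List A) λ u → Σ (List A) λ r → w ≡ u ++ r × P u r

splitting? : {P : List A → List A → Set} → (∀ u r → Dec (P u r)) →
             ∀ w → Dec (Splitting P w)
splitting? {P = P} P? [] = map′ (λ p → [] , [] , refl , p) from-[] (P? [] [])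
  where
  from-[] : Splitting P [] → P [] []
  from-[] ([] , [] , _ , p) = p
splitting? {P = P} P? (x ∷ w) =
  map′ from to (P? [] (x ∷ w) ⊎-dec splitting? (λ u → P? (x ∷ u)) w)
  where
  from : P [] (x ∷ w) ⊎ Splitting (λ u → P (x ∷ u)) w → Splitting P (x ∷ w)
  from (inj₁ p)                  = [] , x ∷ w , refl , p
  from (inj₂ (u , r , w≡u++r , p)) = x ∷ u , r , cong (x ∷_) w≡u++r , p
  to : Splitting P (x ∷ w) → P [] (x ∷ w) ⊎ Splitting (λ u → P (x ∷ u)) w
  to ([]    , r , refl , p) = inj₁ p
  to (_ ∷ u , r , eq   , p) with ∷-injective eq
  ... | refl , w≡u++r = inj₂ (u , r , w≡u++r , p)

shiftIdx-identity : ∀ n → shiftIdx 0 n ≡ n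
shiftIdx-identity zero    = refl
shiftIdx-identity (suc n) = +-identityʳ (suc n)

shiftIdx-injective : ∀ t {m n} → shiftIdx t m ≡ shiftIdx t n → m ≡ n
shiftIdx-injective t {zero}  {zero}  _  = refl
shiftIdx-injective t {suc m} {suc n} eq = +-cancelʳ-≡ t (suc m) (suc n) eq

shiftIdx-mono-≤ : ∀ t {m n} → m ≤ n → shiftIdx t m ≤ shiftIdx t n
shiftIdx-mono-≤ t {zero}          _   = z≤n
shiftIdx-mono-≤ t {suc m} {suc n} m≤n = +-monoˡ-≤ t m≤n

shiftIdx-distrib-⊔ : ∀ t m n → shiftIdx t (m ⊔ n) ≡ shiftIdx t m ⊔ shiftIdx t n
shiftIdx-distrib-⊔ t zero    n       = refl
shiftIdx-distrib-⊔ t (suc m) zero    = refl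
shiftIdx-distrib-⊔ t (suc m) (suc n) = +-distribʳ-⊔ t (suc m) (suc n)

m⊔shiftIdx[m,n]≡n+m : ∀ m n → m ⊔ shiftIdx m n ≡ n + m
m⊔shiftIdx[m,n]≡n+m m zero    = ⊔-identityʳ m
m⊔shiftIdx[m,n]≡n+m m (suc n) = m≤n⇒m⊔n≡n (m≤n+m m (suc n))

T-identity : ∀ w → T 0 w ≡ w
T-identity w = trans (map-cong shiftIdx-identity w) (map-id w)

T-∘ : ∀ s t w → T s (T t w) ≡ T (t + s) w
T-∘ s t []          = refl
T-∘ s t (zero  ∷ w) = cong (zero ∷_) (T-∘ s t w)
T-∘ s t (suc n ∷ w) = cong₂ _∷_ (+-assoc (suc n) t s) (T-∘ s t w)

T-unshift : ∀ t w → map (_∸ t) (T t w) ≡ w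
T-unshift t []          = refl
T-unshift t (zero  ∷ w) = cong₂ _∷_ (0∸n≡0 t) (T-unshift t w)
T-unshift t (suc n ∷ w) = cong₂ _∷_ (m+n∸n≡m (suc n) t) (T-unshift t w)

shifted? : {P : Word → Set} → (∀ v → Dec (P v)) →
           ∀ t r → Dec (Σ Word λ v → P v × r ≡ T t v)
shifted? {P} P? t r = map′ (λ pr → v , pr) to (P? v ×-dec ≡-dec _≟_ r (T t v))
  where
  v : Word
  v = map (_∸ t) r
  to : Σ Word (λ v′ → P v′ × r ≡ T t v′) → P v × r ≡ T t v
  to (v′ , pr) =
    subst (λ z → P z × r ≡ T t z) (sym (trans (cong (map (_∸ t)) (proj₂ pr)) (T-unshift t v′))) pr

∈⇒≤sup : ∀ {j w} → j ∈ w → j ≤ sup w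
∈⇒≤sup {w = x ∷ w} (here refl) = m≤m⊔n x (sup w)
∈⇒≤sup {w = x ∷ w} (there j∈w) = ≤-trans (∈⇒≤sup j∈w) (m≤n⊔m x (sup w))

sup-++ : ∀ u v → sup (u ++ v) ≡ sup u ⊔ sup v
sup-++ []      v = refl
sup-++ (x ∷ u) v = trans (cong (x ⊔_) (sup-++ u v)) (sym (⊔-assoc x (sup u) (sup v)))

sup-T : ∀ t w → sup (T t w) ≡ shiftIdx t (sup w)
sup-T t []      = refl
sup-T t (n ∷ w) = trans (cong (shiftIdx t n ⊔_) (sup-T t w)) (sym (shiftIdx-distrib-⊔ t n (sup w)))

sup-⋆ : ∀ u v → sup (u ⋆ v) ≡ sup v + sup u
sup-⋆ u v = begin
  sup (u ++ T (sup u) v)           ≡⟨ sup-++ u (T (sup u) v) ⟩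
  sup u ⊔ sup (T (sup u) v)        ≡⟨ cong (sup u ⊔_) (sup-T (sup u) v) ⟩
  sup u ⊔ shiftIdx (sup u) (sup v) ≡⟨ m⊔shiftIdx[m,n]≡n+m (sup u) (sup v) ⟩
  sup v + sup u                    ∎
  where open ≡-Reasoning

⋆-identityˡ : ∀ v → [] ⋆ v ≡ v
⋆-identityˡ = T-identity

⋆-assoc : ∀ u v w → (u ⋆ v) ⋆ w ≡ u ⋆ (v ⋆ w)
⋆-assoc u v w = begin
  (u ++ T (sup u) v) ++ T (sup (u ⋆ v)) w
    ≡⟨ ++-assoc u (T (sup u) v) _ ⟩
  u ++ T (sup u) v ++ T (sup (u ⋆ v)) w
    ≡⟨ cong (λ s → u ++ T (sup u) v ++ T s w) (sup-⋆ u v) ⟩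
  u ++ T (sup u) v ++ T (sup v + sup u) w
    ≡⟨ cong (λ z → u ++ T (sup u) v ++ z) (sym (T-∘ (sup u) (sup v) w)) ⟩
  u ++ T (sup u) v ++ T (sup u) (T (sup v) w)
    ≡⟨ cong (u ++_) (sym (map-++ (shiftIdx (sup u)) v (T (sup v) w))) ⟩
  u ++ T (sup u) (v ++ T (sup v) w)
    ∎
  where open ≡-Reasoning

⋆-cancelˡ : ∀ u {v w} → u ⋆ v ≡ u ⋆ w → v ≡ w
⋆-cancelˡ u eq = map-injective (shiftIdx-injective (sup u)) (++-cancelˡ u _ _ eq)

⋆-prod-++ : ∀ us vs → ⋆-prod (us ++ vs) ≡ ⋆-prod us ⋆ ⋆-prod vs
⋆-prod-++ []       vs = sym (⋆-identityˡ (⋆-prod vs))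
⋆-prod-++ (u ∷ us) vs =
  trans (cong (u ⋆_) (⋆-prod-++ us vs)) (sym (⋆-assoc u (⋆-prod us) (⋆-prod vs)))

length-⋆ : ∀ u v → length (u ⋆ v) ≡ length u + length v
length-⋆ u v = trans (length-++ u) (cong (length u +_) (length-map _ v))

length-<-⋆ˡ : ∀ u {v} → NonTrivial v → length u < length (u ⋆ v)
length-<-⋆ˡ u {[]}    v≢[] = ⊥-elim (v≢[] refl)
length-<-⋆ˡ u {x ∷ v} _    =
  subst (length u <_) (sym (length-⋆ u (x ∷ v))) (m<m+n (length u) z<s)

length-<-⋆ʳ : ∀ {u} v → NonTrivial u → length v < length (u ⋆ v)
length-<-⋆ʳ {[]}    v u≢[] = ⊥-elim (u≢[] refl)
length-<-⋆ʳ {x ∷ u} v _    =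
  subst (length v <_) (trans (+-comm (length v) _) (sym (length-⋆ (x ∷ u) v))) (m<m+n (length v) z<s)

DownClosed : Word → Set
DownClosed w = ∀ {j} → j ∈ w → ∀ {i} → 0 < i → i ≤ j → i ∈ w

length-range1 : ∀ j → length (range1 j) ≡ j
length-range1 zero    = refl
length-range1 (suc j) = trans (length-++ (range1 j)) (trans (+-comm _ 1) (cong suc (length-range1 j)))

∈-range1⁺ : ∀ {i j} → 0 < i → i ≤ j → i ∈ range1 j
∈-range1⁺ {j = zero}  0<i i≤0 = ⊥-elim (<⇒≱ 0<i i≤0)
∈-range1⁺ {i} {suc j} 0<i i≤1+j with i ≟ suc j
... | yes refl = ∈-++⁺ʳ (range1 j) (here refl)
... | no  i≢   = ∈-++⁺ˡ (∈-range1⁺ 0<i (≤-pred (≤∧≢⇒< i≤1+j i≢)))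

∈-range1⁻ : ∀ {i j} → i ∈ range1 j → 0 < i × i ≤ j
∈-range1⁻ {j = suc j} i∈ with ∈-++⁻ (range1 j) i∈
... | inj₁ i∈range = Product.map₂ m≤n⇒m≤1+n (∈-range1⁻ i∈range)
... | inj₂ (here refl) = z<s , ≤-refl

packed⇒downClosed : ∀ {w} → Packed w → DownClosed w
packed⇒downClosed {w} packed {j} j∈w 0<i i≤j =
  lookup (subst (All (_∈ w)) (filter-complete (_∈? w) counts) (all-filter (_∈? w) (range1 j)))
         (∈-range1⁺ 0<i i≤j)
  where
  counts : length (filter (_∈? w) (range1 j)) ≡ length (range1 j)
  counts = trans (lookup (map-id-local⁻ packed) j∈w) (sym (length-range1 j))

downClosed⇒packed : ∀ {w} → DownClosed w → Packed w
downClosed⇒packed {w} closed = map-id-local (tabulate φ-fixes)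
  where
  φ-fixes : ∀ {j} → j ∈ w → φ w j ≡ j
  φ-fixes {j} j∈w = trans
    (cong length (filter-all (_∈? w) (tabulate λ i∈ → Product.uncurry (closed j∈w) (∈-range1⁻ i∈))))
    (length-range1 j)

downClosed-⋆ʳ : ∀ u {v} → DownClosed (u ⋆ v) → DownClosed v
downClosed-⋆ʳ u {v} closed j∈v {suc i} _ i≤j
  with ∈-++⁻ u (closed (∈-++⁺ʳ u (∈-map⁺ (shiftIdx (sup u)) j∈v)) z<s (shiftIdx-mono-≤ (sup u) i≤j))
... | inj₁ ∈u = ⊥-elim (<⇒≱ (m<n+m (sup u) z<s) (∈⇒≤sup ∈u))
... | inj₂ ∈Tv with ∈-map⁻ (shiftIdx (sup u)) ∈Tv
...   | y , y∈v , eq = subst (_∈ v) (sym (shiftIdx-injective (sup u) eq)) y∈v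

packed-⋆ʳ : ∀ u {v} → Packed (u ⋆ v) → Packed v
packed-⋆ʳ u = downClosed⇒packed ∘′ downClosed-⋆ʳ u ∘′ packed⇒downClosed

Reducible : Word → Set
Reducible w = Σ Word λ u → Σ Word λ v →
  Packed u × Packed v × NonTrivial u × NonTrivial v × w ≡ u ⋆ v

Atom : Word → Set
Atom v = NonTrivial v × Irreducible v

packed? : ∀ w → Dec (Packed w)
packed? w = ≡-dec _≟_ (pack w) w

nonTrivial? : ∀ w → Dec (NonTrivial w)
nonTrivial? w = ¬? (≡-dec _≟_ w [])

reducible? : ∀ w → Dec (Reducible w)
reducible? w = map′ from to (splitting? split? w)
  where
  Good : Word → Set
  Good u = Packed u × NonTrivial u
  good? : ∀ u → Dec (Good u)
  good? u = packed? u ×-dec nonTrivial? u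
  Split : Word → Word → Set
  Split u r = Good u × Σ Word λ v → Good v × r ≡ T (sup u) v
  split? : ∀ u r → Dec (Split u r)
  split? u r = good? u ×-dec shifted? good? (sup u) r
  from : Splitting Split w → Reducible w
  from (u , r , w≡ , (pu , nu) , v , (pv , nv) , r≡) =
    u , v , pu , pv , nu , nv , trans w≡ (cong (u ++_) r≡)
  to : Reducible w → Splitting Split w
  to (u , v , pu , pv , nu , nv , w≡) = u , T (sup u) v , w≡ , (pu , nu) , v , (pv , nv) , refl

Factorisation : Word → Set
Factorisation w = Σ (List Word) λ vs → All Atom vs × ⋆-prod vs ≡ w

factorisation-⋆ : ∀ {u v} → Factorisation u → Factorisation v → Factorisation (u ⋆ v)
factorisation-⋆ (us , atoms , refl) (vs , atoms′ , refl) =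
  us ++ vs , ++⁺ atoms atoms′ , ⋆-prod-++ us vs

irreducible-factorisation : ∀ {w} → Packed w → ¬ Reducible w → Factorisation w
irreducible-factorisation {[]}    _  _          = [] , [] , refl
irreducible-factorisation {x ∷ w} pw irreducible =
  (x ∷ w) ∷ [] , ((λ ()) , pw , irreducible) ∷ [] , ++-identityʳ (x ∷ w)

factorise : ∀ w → Acc (_<_ on length) w → Packed w → Factorisation w
factorise w (acc shorter) pw with reducible? w
... | no irreducible = irreducible-factorisation pw irreducible
... | yes (u , v , pu , pv , nu , nv , refl) =
  factorisation-⋆ (factorise u (shorter (length-<-⋆ˡ u nv)) pu)
                  (factorise v (shorter (length-<-⋆ʳ v nu)) pv)

irreducible-⋆-prefix : ∀ {a b c d} → Irreducible c → Packed a → NonTrivial a →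
                       a ⋆ b ≡ c ⋆ d → length a ≤ length c → c ≡ a
irreducible-⋆-prefix {a} {b} {c} (pc , irreducible) pa na eq a≤c
  with ++-prefix a c a≤c eq
... | m , c≡a++m , Tb≡m++Td with map-prefix (shiftIdx (sup a)) b m Tb≡m++Td
...   | []         , refl = trans c≡a++m (++-identityʳ a)
...   | b₁@(_ ∷ _) , Tb₁≡m =
  ⊥-elim (irreducible (a , b₁ , pa , packed-⋆ʳ a (subst Packed c≡a⋆b₁ pc) , na , (λ ()) , c≡a⋆b₁))
  where
  c≡a⋆b₁ : c ≡ a ⋆ b₁
  c≡a⋆b₁ = trans c≡a++m (cong (a ++_) (sym Tb₁≡m))

⋆-atom-unique : ∀ {a b c d} → Atom a → Atom c → a ⋆ b ≡ c ⋆ d → a ≡ c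
⋆-atom-unique {a} {c = c} (na , ia) (nc , ic) eq with ≤-total (length a) (length c)
... | inj₁ a≤c = sym (irreducible-⋆-prefix ic (proj₁ ia) na eq a≤c)
... | inj₂ c≤a = irreducible-⋆-prefix ia (proj₁ ic) nc (sym eq) c≤a

⋆-prod-injective : ∀ {vs vs′} → All Atom vs → All Atom vs′ → ⋆-prod vs ≡ ⋆-prod vs′ → vs ≡ vs′
⋆-prod-injective []             []               _  = refl
⋆-prod-injective []             ((nv′ , _) ∷ _) eq = ⊥-elim (nv′ (++-conicalˡ _ _ (sym eq)))
⋆-prod-injective ((nv , _) ∷ _) []               eq = ⊥-elim (nv (++-conicalˡ _ _ eq))
⋆-prod-injective {v ∷ _} (av ∷ atoms) (av′ ∷ atoms′) eq with ⋆-atom-unique av av′ eq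
... | refl = cong (v ∷_) (⋆-prod-injective atoms atoms′ (⋆-cancelˡ v eq))

proposition2 : (w : Word) → Packed w →
    Σ (List Word) λ vs →
      (All (λ v → NonTrivial v × Irreducible v) vs × ⋆-prod vs ≡ w) ×
      ((vs′ : List Word) → All (λ v → NonTrivial v × Irreducible v) vs′ →
        ⋆-prod vs′ ≡ w → vs′ ≡ vs)
proposition2 w pw =
  let vs , atoms , vs≡w = factorise w (wellFounded length <-wellFounded w) pw
  in vs , (atoms , vs≡w) , λ vs′ atoms′ vs′≡w →
       ⋆-prod-injective atoms′ atoms (trans vs′≡w (sym vs≡w))
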